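{- Let $k\ge2$ and $2\le i\le k$ be integers, $\lambda$ a positive integer, and $a_{k,n}^{i}$ the $i$-th sequence of generalized order-$k$ numbers defined in the context. For $m\ge1$ let $D_{k,m}=(d_{st})$ be the $m\times m$ matrix with $d_{st}=1$ if $-1\le s-t<k$ and $s\ne t$, $d_{ss}=\lambda$, and $d_{st}=0$ otherwise. For $n\ge2$ let $D_{k,n}^{i}$ be the $n\times n$ matrix whose first row is $(1,1,0,\dots,0)$, whose first column has entry $1$ in rows $1,\dots,\min(n,k-i+1)$ and $0$ in the remaining rows (so it contains $k-i+1$ ones when $n\ge k-i+1$), and whose submatrix obtained by deleting the first row and first column is $D_{k,n-1}$. Then $\operatorname{per}(D_{k,n}^{i})=a_{k,n}^{i}$, where $\operatorname{per}$ denotes the permanent.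
   Context: For a positive integer $k$ and a positive integer $\lambda$, the $k$ sequences of generalized order-$k$ numbers are defined as follows: for each $1\le i\le k$, the sequence $(a_{k,n}^{i})_{n\ge 1-k}$ has initial values $a_{k,n}^{i}=1$ if $i=1-n$ and $a_{k,n}^{i}=0$ otherwise, for $1-k\le n\le 0$, and satisfies $a_{k,n}^{i}=\lambda a_{k,n-1}^{i}+a_{k,n-2}^{i}+\cdots+a_{k,n-k}^{i}$ for $n\ge 1$. -}

module Defs where

open import Data.Nat using (ℕ; zero; suc; _+_; _*_; _∸_; _≤_; _<_; _≟_; _<?_; _≤?_)
open import Data.Fin using (Fin; toℕ)
open import Data.Vec using (Vec; []; _∷_; lookup)
open import Data.List using (List; []; _∷_; map; concatMap; allFin; filter)
open import Data.Nat.ListAction using (sum; product)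
open import Data.Bool using (Bool; true; false; if_then_else_; _∧_)
open import Data.Integer as ℤ using (ℤ)
open import Relation.Nullary using (Dec; yes; no; ¬_)
open import Relation.Nullary.Decidable using (⌊_⌋)
open import Data.List.Relation.Unary.Unique.Propositional using (Unique)
open import Data.List.Relation.Unary.Unique.Propositional.Properties using ()
open import Data.Vec using (toList)

-- The paper indexes a^i_{k,n} by n ≥ 1-k.  We shift the index:
-- seqShift k λ i j = a^i_{k, j+1-k}   (j : ℕ, so j = n + k - 1).
-- Initial values (j < k, i.e. 1-k ≤ n ≤ 0): 1 iff i = 1 - n = k - j.
-- Recurrence (j ≥ k, i.e. n ≥ 1):
--   a_n = λ a_{n-1} + a_{n-2} + ... + a_{n-k}.

sumFrom2 : (k : ℕ) → (ℕ → ℕ) → ℕ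
sumFrom2 zero f = 0
sumFrom2 (suc zero) f = 0
sumFrom2 (suc (suc k)) f = sumFrom2 (suc k) f + f (suc (suc k))

-- table of values g 0 .. g j, computed as a list in reverse order
-- (head = g j) to obtain structural recursion.
private
  nth : List ℕ → ℕ → ℕ
  nth [] _ = 0
  nth (x ∷ xs) zero = x
  nth (x ∷ xs) (suc r) = nth xs r

hist : (k λ' i : ℕ) → ℕ → List ℕ
hist k λ' i zero = (if ⌊ i ≟ k ⌋ then 1 else 0) ∷ []
hist k λ' i (suc j) with suc j <? k
... | yes _ = (if ⌊ i ≟ k ∸ suc j ⌋ then 1 else 0) ∷ hist k λ' i j
... | no _  = let h = hist k λ' i j in
              -- g (suc j - r) = nth h (r - 1) for r ≥ 1
              (λ' * nth h 0 + sumFrom2 k (λ r → nth h (r ∸ 1))) ∷ h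

seqShift : (k λ' i j : ℕ) → ℕ
seqShift k λ' i j with hist k λ' i j
... | [] = 0
... | x ∷ _ = x

-- a^i_{k,n} for n ≥ 1 (n : ℕ); n = 0 also correct (j = k - 1).
gon : (k λ' i n : ℕ) → ℕ
gon k λ' i n = seqShift k λ' i (n + k ∸ 1)

-- Permanent: per(A) = Σ_{σ ∈ S_n} Π_s A s (σ s).
-- S_n is enumerated as the duplicate-free vectors in Vec (Fin n) n
-- (these are exactly the permutations of Fin n).

Matrix : ℕ → Set
Matrix n = Fin n → Fin n → ℕ

allVecs : (m n : ℕ) → List (Vec (Fin n) m)
allVecs zero n = [] ∷ []
allVecs (suc m) n = concatMap (λ x → map (x ∷_) (allVecs m n)) (allFin n)

private
  notIn : ∀ {n m} → Fin n → Vec (Fin n) m → Bool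
  notIn x [] = true
  notIn x (y ∷ ys) = (if ⌊ toℕ x ≟ toℕ y ⌋ then false else true) ∧ notIn x ys

  distinct : ∀ {n m} → Vec (Fin n) m → Bool
  distinct [] = true
  distinct (x ∷ xs) = notIn x xs ∧ distinct xs

isPerm : ∀ {n} → Vec (Fin n) n → Bool
isPerm = distinct

perms : (n : ℕ) → List (Vec (Fin n) n)
perms n = Data.List.filter (λ σ → Data.Bool._≟_ (isPerm σ) true) (allVecs n n)
  where import Data.Bool

per : ∀ {n} → Matrix n → ℕ
per {n} A = sum (map (λ σ → product (map (λ s → A s (lookup σ s)) (allFin n))) (perms n))

-- The matrices.  Rows/columns are 1-based in the paper: s = toℕ s' + 1.

Dmat : (k λ' m : ℕ) → Matrix m
Dmat k λ' m s t with toℕ s ≟ toℕ t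
... | yes _ = λ'
... | no _ = if ⌊ toℕ t ≤? suc (toℕ s) ⌋ ∧ ⌊ toℕ s <? toℕ t + k ⌋ then 1 else 0

Dimat : (k λ' i n' : ℕ) → Matrix (suc n')
Dimat k λ' i n' Fin.zero Fin.zero = 1
Dimat k λ' i n' Fin.zero (Fin.suc t) = if ⌊ toℕ t ≟ 0 ⌋ then 1 else 0
Dimat k λ' i n' (Fin.suc s) Fin.zero = if ⌊ suc (toℕ s) <? k ∸ i + 1 ⌋ then 1 else 0
Dimat k λ' i n' (Fin.suc s) (Fin.suc t) = Dmat k λ' n' s t

{-# OPTIONS --safe #-}
-- D^i_{k,n} is lower Hessenberg with ones on the superdiagonal, so the permanents P_j of its
-- leading j × j submatrices satisfy P_{m+1} = Σ_{j ≤ m} d_{m,j} P_j, with P_0 = 1 (expand along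
-- the last row).  Apart from the first column, row m ≥ 1 has λ on the diagonal and ones in the
-- k − 1 columns to its left, which reproduces a_n = λ a_{n-1} + a_{n-2} + ⋯ + a_{n-k} term by
-- term; the terms reaching back to the initial values a_{1-k}, …, a_0 add up to d_{m,0}, because
-- among those only a_{1-i} is nonzero.
module Submission where

open import Data.Bool using (Bool; true; false; if_then_else_; _∧_)
import Data.Bool as Bool
open import Data.Empty using (⊥-elim)
open import Data.Fin using (Fin; toℕ) renaming (zero to fzero; suc to fsuc)
open import Data.List using (List; []; _∷_; _++_; map; concatMap; allFin; filter; tabulate; head)
open import Data.List.Properties using (map-++; map-cong; map-∘; map-tabulate)
open import Data.Nat using (ℕ; zero; suc; _+_; _*_; _∸_; _⊓_; _≤_; _<_; _≥_; _≟_; _<?_; _≤?_; z≤n; s≤s; s≤s⁻¹)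
open import Data.Maybe using (fromMaybe)
open import Data.Nat.Induction using (<-rec)
open import Data.Nat.ListAction using (sum; product)
open import Data.Nat.ListAction.Properties using (sum-++)
open import Data.Nat.Properties
open import Algebra.Properties.CommutativeSemigroup +-commutativeSemigroup using (interchange)
open import Data.Nat.Solver using (module +-*-Solver)
open import Data.Vec using (Vec; []; _∷_; lookup)
open import Function using (_∘_)
open import Function.Bundles using (mk⇔)
open import Relation.Binary.PropositionalEquality
open import Relation.Nullary using (Dec; yes; no; ¬_)
open import Relation.Nullary.Decidable using (⌊_⌋; isYes≗does; does-⇔; dec-true)

open import Defs

-- Defs keeps notIn, distinct and nth private, but their unfoldings are visible, so the two
-- equations in this block determine the metavariables by unification (abstracting over the
-- size makes the problems patterns).  back h r = nth h (r ∸ 1) is the value r steps before the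
-- one hist is about to push.
mutual
  notIn′ : ∀ {N m} → Fin N → Vec (Fin N) m → Bool
  notIn′ = _

  distinct′ : ∀ {N m} → Vec (Fin N) m → Bool
  distinct′ = _

  back : List ℕ → ℕ → ℕ
  back = _

  isPerm-∷-∷ : ∀ m (x y : Fin (suc (suc m))) (w : Vec (Fin (suc (suc m))) m) →
    isPerm (x ∷ y ∷ w) ≡ ((if ⌊ toℕ x ≟ toℕ y ⌋ then false else true) ∧ notIn′ x w) ∧ (notIn′ y w ∧ distinct′ w)
  isPerm-∷-∷ m with suc (suc m)
  ... | N = λ x y w → refl

  hist-step : ∀ k λ' i j → ¬ suc j < k →
    hist k λ' i (suc j) ≡ (λ' * back (hist k λ' i j) 1 + sumFrom2 k (back (hist k λ' i j))) ∷ hist k λ' i j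
  hist-step k λ' i j j+1≮k with suc j <? k
  ... | yes j+1<k = ⊥-elim (j+1≮k j+1<k)
  ... | no _ with hist k λ' i j
  ...   | h = refl

isPerm≡distinct′ : ∀ {n} (σ : Vec (Fin n) n) → isPerm σ ≡ distinct′ σ
isPerm≡distinct′ []          = refl
isPerm≡distinct′ (x ∷ [])    = refl
isPerm≡distinct′ (x ∷ y ∷ w) = isPerm-∷-∷ _ x y w

⌊⌋-⇔ : ∀ {P Q : Set} (p? : Dec P) (q? : Dec Q) → (P → Q) → (Q → P) → ⌊ p? ⌋ ≡ ⌊ q? ⌋
⌊⌋-⇔ p? q? P→Q Q→P = trans (isYes≗does p?) (trans (does-⇔ (mk⇔ P→Q Q→P) p? q?) (sym (isYes≗does q?)))

⌊⌋-true : ∀ {P : Set} (p? : Dec P) → P → ⌊ p? ⌋ ≡ true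
⌊⌋-true p? p = trans (isYes≗does p?) (dec-true p? p)

if-split : ∀ (b : Bool) x → x ≡ (if b then x else 0) + (if b then 0 else x)
if-split true  x = sym (+-identityʳ x)
if-split false x = refl

*-if-1-0 : ∀ x (b : Bool) → x * (if b then 1 else 0) ≡ (if b then x else 0)
*-if-1-0 x true  = *-identityʳ x
*-if-1-0 x false = *-zeroʳ x

∑ : ℕ → (ℕ → ℕ) → ℕ
∑ zero    f = 0
∑ (suc n) f = f 0 + ∑ n (f ∘ suc)

syntax ∑ n (λ j → e) = ∑[ j < n ] e

∑-cong : ∀ n {f g : ℕ → ℕ} → (∀ j → j < n → f j ≡ g j) → ∑ n f ≡ ∑ n g
∑-cong zero    f≗g = refl
∑-cong (suc n) f≗g = cong₂ _+_ (f≗g 0 (s≤s z≤n)) (∑-cong n (λ j j<n → f≗g (suc j) (s≤s j<n)))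

∑-distrib-+ : ∀ n (f g : ℕ → ℕ) → ∑[ j < n ] (f j + g j) ≡ ∑ n f + ∑ n g
∑-distrib-+ zero    f g = refl
∑-distrib-+ (suc n) f g =
  trans (cong (f 0 + g 0 +_) (∑-distrib-+ n (f ∘ suc) (g ∘ suc))) (interchange (f 0) (g 0) _ _)

∑-distribˡ-* : ∀ n c (f : ℕ → ℕ) → ∑[ j < n ] (c * f j) ≡ c * ∑ n f
∑-distribˡ-* zero    c f = sym (*-zeroʳ c)
∑-distribˡ-* (suc n) c f =
  trans (cong (c * f 0 +_) (∑-distribˡ-* n c (f ∘ suc))) (sym (*-distribˡ-+ c (f 0) _))

∑-suc : ∀ n (f : ℕ → ℕ) → ∑ (suc n) f ≡ ∑ n f + f n
∑-suc zero    f = +-identityʳ (f 0)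
∑-suc (suc n) f = trans (cong (f 0 +_) (∑-suc n (f ∘ suc))) (sym (+-assoc (f 0) _ _))

∑-indicator : ∀ n a c → ∑[ d < n ] (if ⌊ d ≟ a ⌋ then c else 0) ≡ (if ⌊ a <? n ⌋ then c else 0)
∑-indicator zero    a c = refl
∑-indicator (suc n) a c
  rewrite ∑-suc n (λ d → if ⌊ d ≟ a ⌋ then c else 0) | ∑-indicator n a c
  with a <? n | n ≟ a | a <? suc n
... | yes a<n | yes refl | _         = ⊥-elim (<-irrefl refl a<n)
... | yes _   | no _     | yes _     = +-identityʳ c
... | yes a<n | no _     | no a≮n+1  = ⊥-elim (a≮n+1 (m<n⇒m<1+n a<n))
... | no _    | yes refl | yes _     = refl
... | no _    | yes refl | no a≮a+1  = ⊥-elim (a≮a+1 (n<1+n a))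
... | no a≮n  | no n≢a   | yes a<n+1 = ⊥-elim (a≮n (≤∧≢⇒< (≤-pred a<n+1) (n≢a ∘ sym)))
... | no _    | no _     | no _      = refl

∑-below : ∀ a b (f : ℕ → ℕ) → ∑[ d < a ] (if ⌊ d <? b ⌋ then f d else 0) ≡ ∑ (a ⊓ b) f
∑-below zero    b f = refl
∑-below (suc a) b f
  rewrite ∑-suc a (λ d → if ⌊ d <? b ⌋ then f d else 0) | ∑-below a b f
  with a <? b
... | yes a<b rewrite m≤n⇒m⊓n≡m (<⇒≤ a<b) | m≤n⇒m⊓n≡m a<b = sym (∑-suc a f)
... | no a≮b  rewrite m≥n⇒m⊓n≡n (≮⇒≥ a≮b) | m≥n⇒m⊓n≡n (m≤n⇒m≤1+n (≮⇒≥ a≮b)) = +-identityʳ _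

∑-reverse : ∀ n (f : ℕ → ℕ) → ∑ n f ≡ ∑[ e < n ] f (n ∸ suc e)
∑-reverse zero    f = refl
∑-reverse (suc n) f = begin
  f 0 + ∑ n (f ∘ suc)                           ≡⟨ cong (f 0 +_) (∑-reverse n (f ∘ suc)) ⟩
  f 0 + ∑[ e < n ] f (suc (n ∸ suc e))          ≡⟨ cong (f 0 +_) (∑-cong n (λ e e<n → cong f (sym (+-∸-assoc 1 e<n)))) ⟩
  f 0 + ∑[ e < n ] f (n ∸ e)                    ≡⟨ +-comm (f 0) _ ⟩
  ∑[ e < n ] f (n ∸ e) + f 0                    ≡⟨ cong (λ z → ∑[ e < n ] f (n ∸ e) + f z) (n∸n≡0 n) ⟨
  ∑[ e < n ] f (n ∸ e) + f (n ∸ n)              ≡⟨ ∑-suc n (λ e → f (n ∸ e)) ⟨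
  ∑[ e < suc n ] f (suc n ∸ suc e)              ∎
  where open ≡-Reasoning

∑-two-support : ∀ N (f : ℕ → ℕ) a b → a ≢ b → (∀ x → x ≢ a → x ≢ b → f x ≡ 0) →
  ∑ N f ≡ (if ⌊ a <? N ⌋ then f a else 0) + (if ⌊ b <? N ⌋ then f b else 0)
∑-two-support N f a b a≢b elsewhere =
  trans (∑-cong N split)
    (trans (∑-distrib-+ N _ _) (cong₂ _+_ (∑-indicator N a (f a)) (∑-indicator N b (f b))))
  where
  split : ∀ x → x < N → f x ≡ (if ⌊ x ≟ a ⌋ then f a else 0) + (if ⌊ x ≟ b ⌋ then f b else 0)
  split x _ with x ≟ a | x ≟ b
  ... | yes refl | yes refl = ⊥-elim (a≢b refl)
  ... | yes refl | no _     = sym (+-identityʳ (f x))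
  ... | no _     | yes refl = refl
  ... | no x≢a   | no x≢b   = elsewhere x x≢a x≢b

-- Row expansion of the permanent

minor : ℕ → (ℕ → ℕ → ℕ) → ℕ → ℕ → ℕ
minor x A r t = if ⌊ x ≟ t ⌋ then 0 else A (suc r) t

-- per′ N m A sums, over the injective maps from rows 0 … m − 1 to columns 0 … N − 1, the
-- products of the chosen entries; a used column is zeroed rather than deleted, so that column
-- indices never shift.
per′ : ℕ → ℕ → (ℕ → ℕ → ℕ) → ℕ
per′ N zero    A = 1
per′ N (suc m) A = ∑[ x < N ] (A 0 x * per′ N m (minor x A))

per′-cong : ∀ N m {A B : ℕ → ℕ → ℕ} → (∀ r t → A r t ≡ B r t) → per′ N m A ≡ per′ N m B
per′-cong N zero    A≗B = refl
per′-cong N (suc m) A≗B = ∑-cong N (λ x _ → cong₂ _*_ (A≗B 0 x)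
  (per′-cong N m (λ r t → cong (λ z → if ⌊ x ≟ t ⌋ then 0 else z) (A≗B (suc r) t))))

sum-concatMap : ∀ {X Y : Set} (F : Y → ℕ) (g : X → List Y) xs →
  sum (map F (concatMap g xs)) ≡ sum (map (λ x → sum (map F (g x))) xs)
sum-concatMap F g []       = refl
sum-concatMap F g (x ∷ xs) = begin
  sum (map F (g x ++ concatMap g xs))                        ≡⟨ cong sum (map-++ F (g x) (concatMap g xs)) ⟩
  sum (map F (g x) ++ map F (concatMap g xs))                ≡⟨ sum-++ (map F (g x)) _ ⟩
  sum (map F (g x)) + sum (map F (concatMap g xs))           ≡⟨ cong (sum (map F (g x)) +_) (sum-concatMap F g xs) ⟩
  sum (map F (g x)) + sum (map (λ x → sum (map F (g x))) xs) ∎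
  where open ≡-Reasoning

sum-map-distribˡ-* : ∀ {X : Set} c (h : X → ℕ) xs → sum (map (λ v → c * h v) xs) ≡ c * sum (map h xs)
sum-map-distribˡ-* c h []       = sym (*-zeroʳ c)
sum-map-distribˡ-* c h (x ∷ xs) =
  trans (cong (c * h x +_) (sum-map-distribˡ-* c h xs)) (sym (*-distribˡ-+ c (h x) _))

sum-tabulate : ∀ N (g : ℕ → ℕ) → sum (tabulate {n = N} (g ∘ toℕ)) ≡ ∑ N g
sum-tabulate zero    g = refl
sum-tabulate (suc N) g = cong (g 0 +_) (sum-tabulate N (g ∘ suc))

sum-allFin : ∀ N (g : ℕ → ℕ) → sum (map (g ∘ toℕ) (allFin N)) ≡ ∑ N g
sum-allFin N g = trans (cong sum (map-tabulate {n = N} (λ x → x) (g ∘ toℕ))) (sum-tabulate N g)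

rowProduct : ∀ {N} m → (Fin m → Fin N → ℕ) → Vec (Fin N) m → ℕ
rowProduct m B v = product (tabulate (λ s → B s (lookup v s)))

rowProduct-zeroColumn : ∀ {N} m (x : Fin N) (B : Fin m → Fin N → ℕ) (v : Vec (Fin N) m) →
  rowProduct m (λ s t → if ⌊ toℕ x ≟ toℕ t ⌋ then 0 else B s t) v ≡ (if notIn′ x v then rowProduct m B v else 0)
rowProduct-zeroColumn zero    x B []      = refl
rowProduct-zeroColumn (suc m) x B (y ∷ w) with toℕ x ≟ toℕ y
... | yes _ = refl
... | no _ rewrite rowProduct-zeroColumn m x (B ∘ fsuc) w with notIn′ x w
...   | true  = refl
...   | false = *-zeroʳ (B fzero y)

per′-allVecs : ∀ {N} m (B : Fin m → Fin N → ℕ) (A : ℕ → ℕ → ℕ) → (∀ s t → B s t ≡ A (toℕ s) (toℕ t)) →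
  sum (map (λ v → if distinct′ v then rowProduct m B v else 0) (allVecs m N)) ≡ per′ N m A
per′-allVecs zero    B A B≗A = refl
per′-allVecs {N} (suc m) B A B≗A =
  trans (sum-concatMap F (λ x → map (x ∷_) (allVecs m N)) (allFin N))
    (trans (cong sum (map-cong firstRow (allFin N)))
      (sum-allFin N (λ x → A 0 x * per′ N m (minor x A))))
  where
  F : Vec (Fin N) (suc m) → ℕ
  F v = if distinct′ v then rowProduct (suc m) B v else 0
  B′ : Fin N → Fin m → Fin N → ℕ
  B′ x s t = if ⌊ toℕ x ≟ toℕ t ⌋ then 0 else B (fsuc s) t
  F-∷ : ∀ x v → F (x ∷ v) ≡ B fzero x * (if distinct′ v then rowProduct m (B′ x) v else 0)
  F-∷ x v rewrite rowProduct-zeroColumn m x (B ∘ fsuc) v with notIn′ x v | distinct′ v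
  ... | true  | true  = refl
  ... | true  | false = sym (*-zeroʳ (B fzero x))
  ... | false | true  = sym (*-zeroʳ (B fzero x))
  ... | false | false = sym (*-zeroʳ (B fzero x))
  firstRow : ∀ x → sum (map F (map (x ∷_) (allVecs m N))) ≡ A 0 (toℕ x) * per′ N m (minor (toℕ x) A)
  firstRow x = begin
    sum (map F (map (x ∷_) (allVecs m N)))                      ≡⟨ cong sum (map-∘ (allVecs m N)) ⟨
    sum (map (F ∘ (x ∷_)) (allVecs m N))                        ≡⟨ cong sum (map-cong (F-∷ x) (allVecs m N)) ⟩
    sum (map (λ v → B fzero x * _) (allVecs m N))               ≡⟨ sum-map-distribˡ-* (B fzero x) _ (allVecs m N) ⟩
    B fzero x * sum (map _ (allVecs m N))                       ≡⟨ cong₂ _*_ (B≗A fzero x) (per′-allVecs m (B′ x) _ B′≗minor) ⟩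
    A 0 (toℕ x) * per′ N m (minor (toℕ x) A)                    ∎
    where
    open ≡-Reasoning
    B′≗minor : ∀ s t → B′ x s t ≡ minor (toℕ x) A (toℕ s) (toℕ t)
    B′≗minor s t = cong (λ z → if ⌊ toℕ x ≟ toℕ t ⌋ then 0 else z) (B≗A (fsuc s) t)

sum-filter-isPerm : ∀ {n} (f : Vec (Fin n) n → ℕ) σs →
  sum (map f (filter (λ σ → isPerm σ Bool.≟ true) σs)) ≡ sum (map (λ σ → if isPerm σ then f σ else 0) σs)
sum-filter-isPerm f []       = refl
sum-filter-isPerm f (σ ∷ σs) with isPerm σ
... | true  = cong (f σ +_) (sum-filter-isPerm f σs)
... | false = sum-filter-isPerm f σs

per≡per′ : ∀ n (M : Matrix n) (A : ℕ → ℕ → ℕ) → (∀ s t → M s t ≡ A (toℕ s) (toℕ t)) → per M ≡ per′ n n A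
per≡per′ n M A M≗A =
  trans (sum-filter-isPerm _ (allVecs n n))
    (trans (cong sum (map-cong summand (allVecs n n))) (per′-allVecs n M A M≗A))
  where
  summand : ∀ σ → (if isPerm σ then product (map (λ s → M s (lookup σ s)) (allFin n)) else 0)
                ≡ (if distinct′ σ then rowProduct n M σ else 0)
  summand σ = cong₂ (λ b z → if b then product z else 0)
    (isPerm≡distinct′ σ) (map-tabulate {n = n} (λ x → x) (λ s → M s (lookup σ s)))

-- Lower Hessenberg matrices with unit superdiagonal

block : (ℕ → ℕ → ℕ) → ℕ → ℕ → ℕ → ℕ → ℕ
block A s h r t = if ⌊ t ≟ h ⌋ then A (r + s) t else (if ⌊ t ≤? s ⌋ then 0 else A (r + s) t)

-- hper A m s h is the permanent of rows s, …, s + m − 1 of A on the columns h, s + 1, s + 2, …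
-- (the rows of block A s h).  When A is lower Hessenberg with unit superdiagonal, the first of
-- these rows meets only the columns h and s + 1, whence the recurrence.
hper : (ℕ → ℕ → ℕ) → ℕ → ℕ → ℕ → ℕ
hper A zero          s h = 1
hper A (suc zero)    s h = A s h
hper A (suc (suc m)) s h = A s h * hper A (suc m) (suc s) (suc s) + hper A (suc m) (suc s) h

block-0-0 : ∀ (A : ℕ → ℕ → ℕ) r t → block A 0 0 r t ≡ A r t
block-0-0 A r zero    = cong (λ r → A r 0) (+-identityʳ r)
block-0-0 A r (suc t) = cong (λ r → A r (suc t)) (+-identityʳ r)

minor-block-h : ∀ (A : ℕ → ℕ → ℕ) s h → h ≤ s → ∀ r t →
  minor h (block A s h) r t ≡ block A (suc s) (suc s) r t
minor-block-h A s h h≤s r t rewrite +-suc r s with h ≟ t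
... | yes refl with h ≟ suc s | h ≤? suc s
...   | yes h≡s+1 | _        = ⊥-elim (<-irrefl h≡s+1 (s≤s h≤s))
...   | no _      | yes _    = refl
...   | no _      | no h≰s+1 = ⊥-elim (h≰s+1 (m≤n⇒m≤1+n h≤s))
minor-block-h A s h h≤s r t | no h≢t with t ≟ h
...   | yes t≡h = ⊥-elim (h≢t (sym t≡h))
...   | no _ with t ≟ suc s
...     | yes refl with suc s ≤? s
...       | yes s+1≤s = ⊥-elim (<-irrefl refl s+1≤s)
...       | no _      = refl
minor-block-h A s h h≤s r t | no _ | no _ | no t≢s+1 with t ≤? s | t ≤? suc s
...       | yes _   | yes _     = refl
...       | no _    | no _      = refl
...       | yes t≤s | no t≰s+1  = ⊥-elim (t≰s+1 (m≤n⇒m≤1+n t≤s))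
...       | no t≰s  | yes t≤s+1 = ⊥-elim (t≰s (s≤s⁻¹ (≤∧≢⇒< t≤s+1 t≢s+1)))

minor-block-s+1 : ∀ (A : ℕ → ℕ → ℕ) s h → h ≤ s → ∀ r t →
  minor (suc s) (block A s h) r t ≡ block A (suc s) h r t
minor-block-s+1 A s h h≤s r t rewrite +-suc r s with suc s ≟ t
... | yes refl with suc s ≟ h | suc s ≤? suc s
...   | yes s+1≡h | _          = ⊥-elim (<-irrefl (sym s+1≡h) (s≤s h≤s))
...   | no _      | yes _      = refl
...   | no _      | no s+1≰s+1 = ⊥-elim (s+1≰s+1 ≤-refl)
minor-block-s+1 A s h h≤s r t | no s+1≢t with t ≟ h
...   | yes _ = refl
...   | no _ with t ≤? s | t ≤? suc s
...       | yes _   | yes _     = refl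
...       | no _    | no _      = refl
...       | yes t≤s | no t≰s+1  = ⊥-elim (t≰s+1 (m≤n⇒m≤1+n t≤s))
...       | no t≰s  | yes t≤s+1 = ⊥-elim (t≰s (s≤s⁻¹ (≤∧≢⇒< t≤s+1 (s+1≢t ∘ sym))))

block-superdiagonal : ∀ (A : ℕ → ℕ → ℕ) s h → h ≤ s → block A s h 0 (suc s) ≡ A s (suc s)
block-superdiagonal A s h h≤s with suc s ≟ h
... | yes s+1≡h = ⊥-elim (<-irrefl (sym s+1≡h) (s≤s h≤s))
... | no _ with suc s ≤? s
...   | yes s+1≤s = ⊥-elim (<-irrefl refl s+1≤s)
...   | no _      = refl

hper-suc : ∀ (A : ℕ → ℕ → ℕ) m s h →
  A s h * hper A m (suc s) (suc s) + (if ⌊ suc s <? s + suc m ⌋ then hper A m (suc s) h else 0) ≡ hper A (suc m) s h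
hper-suc A zero s h with suc s <? s + 1
... | yes s+1<s+1 = ⊥-elim (<-irrefl (+-comm 1 s) s+1<s+1)
... | no _        = trans (+-identityʳ _) (*-identityʳ _)
hper-suc A (suc m) s h with suc s <? s + suc (suc m)
... | yes _  = refl
... | no s+1≮ = ⊥-elim (s+1≮ (subst (suc s <_) (sym (+-suc s (suc m))) (s≤s (m<m+n s (s≤s z≤n)))))

hper-lastRow : ∀ (A : ℕ → ℕ → ℕ) m s h →
  hper A (suc m) s h ≡ A (s + m) h + ∑[ j < m ] (hper A (suc j) s h * A (s + m) (s + suc j))
hper-lastRow A zero    s h = trans (cong (λ r → A r h) (sym (+-identityʳ s))) (sym (+-identityʳ _))
hper-lastRow A (suc m) s h rewrite +-suc s m | hper-lastRow A m (suc s) (suc s) | hper-lastRow A m (suc s) h =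
  trans (regroup a (A M (suc s)) (∑[ j < m ] (X₁ j * c j)) (A M h) (∑[ j < m ] (X₂ j * c j)))
    (cong (A M h +_) (cong₂ _+_ (cong (λ z → a * A M z) (+-comm 1 s)) (sym expand)))
  where
  open +-*-Solver
  regroup : ∀ a b c d e → a * (b + c) + (d + e) ≡ d + (a * b + (a * c + e))
  regroup = solve 5 (λ a b c d e → a :* (b :+ c) :+ (d :+ e) := d :+ (a :* b :+ (a :* c :+ e))) refl
  distribute : ∀ a x y c → (a * x + y) * c ≡ a * (x * c) + y * c
  distribute = solve 4 (λ a x y c → (a :* x :+ y) :* c := a :* (x :* c) :+ y :* c) refl
  a = A s h
  M = suc (s + m)
  X₁ = λ j → hper A (suc j) (suc s) (suc s)
  X₂ = λ j → hper A (suc j) (suc s) h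
  c = λ j → A M (suc (s + suc j))
  expand : ∑[ j < m ] (hper A (suc (suc j)) s h * A M (s + suc (suc j)))
         ≡ a * ∑[ j < m ] (X₁ j * c j) + ∑[ j < m ] (X₂ j * c j)
  expand = trans
    (∑-cong m (λ j _ → trans (cong (λ z → hper A (suc (suc j)) s h * A M z) (+-suc s (suc j)))
                             (distribute a (X₁ j) (X₂ j) (c j))))
    (trans (∑-distrib-+ m _ _) (cong (_+ ∑[ j < m ] (X₂ j * c j)) (∑-distribˡ-* m a _)))

module Hessenberg (A : ℕ → ℕ → ℕ) (hessenberg : ∀ r t → suc r < t → A r t ≡ 0)
                  (unit-superdiagonal : ∀ r → A r (suc r) ≡ 1) where

  block-row₀-sparse : ∀ s h x → x ≢ h → x ≢ suc s → block A s h 0 x ≡ 0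
  block-row₀-sparse s h x x≢h x≢s+1 with x ≟ h
  ... | yes x≡h = ⊥-elim (x≢h x≡h)
  ... | no _ with x ≤? s
  ...   | yes _  = refl
  ...   | no x≰s = hessenberg s x (≤∧≢⇒< (≰⇒> x≰s) (x≢s+1 ∘ sym))

  per′-block : ∀ m s h → h ≤ s → per′ (s + m) m (block A s h) ≡ hper A m s h
  per′-block zero    s h h≤s = refl
  per′-block (suc m) s h h≤s = begin
    per′ N (suc m) (block A s h)
      ≡⟨ ∑-two-support N f h (suc s) (λ h≡s+1 → <-irrefl h≡s+1 (s≤s h≤s))
           (λ x x≢h x≢s+1 → cong (_* per′ N m (minor x (block A s h))) (block-row₀-sparse s h x x≢h x≢s+1)) ⟩
    (if ⌊ h <? N ⌋ then f h else 0) + (if ⌊ suc s <? N ⌋ then f (suc s) else 0)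
      ≡⟨ cong₂ _+_ column-h column-s+1 ⟩
    A s h * hper A m (suc s) (suc s) + (if ⌊ suc s <? N ⌋ then hper A m (suc s) h else 0)
      ≡⟨ hper-suc A m s h ⟩
    hper A (suc m) s h ∎
    where
    open ≡-Reasoning
    N = s + suc m
    f : ℕ → ℕ
    f x = block A s h 0 x * per′ N m (minor x (block A s h))
    per′-shifted : ∀ h′ → h′ ≤ suc s → per′ N m (block A (suc s) h′) ≡ hper A m (suc s) h′
    per′-shifted h′ h′≤s+1 = subst (λ M → per′ M m (block A (suc s) h′) ≡ hper A m (suc s) h′)
      (sym (+-suc s m)) (per′-block m (suc s) h′ h′≤s+1)
    column-h : (if ⌊ h <? N ⌋ then f h else 0) ≡ A s h * hper A m (suc s) (suc s)
    column-h with h <? N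
    ... | no h≮N = ⊥-elim (h≮N (≤-<-trans h≤s (m<m+n s (s≤s z≤n))))
    ... | yes _ with h ≟ h
    ...   | no h≢h = ⊥-elim (h≢h refl)
    ...   | yes _  = cong (A s h *_) (trans (per′-cong N m (minor-block-h A s h h≤s)) (per′-shifted (suc s) ≤-refl))
    column-s+1 : (if ⌊ suc s <? N ⌋ then f (suc s) else 0) ≡ (if ⌊ suc s <? N ⌋ then hper A m (suc s) h else 0)
    column-s+1 with suc s <? N
    ... | no _  = refl
    ... | yes _ = begin
      block A s h 0 (suc s) * per′ N m (minor (suc s) (block A s h))
        ≡⟨ cong₂ _*_ (trans (block-superdiagonal A s h h≤s) (unit-superdiagonal s))
                     (trans (per′-cong N m (minor-block-s+1 A s h h≤s)) (per′-shifted h (m≤n⇒m≤1+n h≤s))) ⟩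
      1 * hper A m (suc s) h
        ≡⟨ *-identityˡ _ ⟩
      hper A m (suc s) h ∎

  per′-hper : ∀ m → per′ m m A ≡ hper A m 0 0
  per′-hper m = trans (per′-cong m m (λ r t → sym (block-0-0 A r t))) (per′-block m 0 0 z≤n)

-- The generalized order-k numbers

seqShift≡head : ∀ k λ' i j → seqShift k λ' i j ≡ fromMaybe 0 (head (hist k λ' i j))
seqShift≡head k λ' i j with hist k λ' i j
... | []    = refl
... | _ ∷ _ = refl

seqShift-initial : ∀ k λ' i j → j < k → seqShift k λ' i j ≡ (if ⌊ i ≟ k ∸ j ⌋ then 1 else 0)
seqShift-initial k λ' i zero    _ = seqShift≡head k λ' i zero
seqShift-initial k λ' i (suc j) j+1<k rewrite seqShift≡head k λ' i (suc j) with suc j <? k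
... | yes _    = refl
... | no j+1≮k = ⊥-elim (j+1≮k j+1<k)

back-hist : ∀ k λ' i j r → r ≤ j → back (hist k λ' i j) (suc r) ≡ seqShift k λ' i (j ∸ r)
back-hist k λ' i zero    zero    _ = sym (seqShift≡head k λ' i zero)
back-hist k λ' i (suc j) zero    _ rewrite seqShift≡head k λ' i (suc j) with suc j <? k
... | yes _ = refl
... | no _  = refl
back-hist k λ' i (suc j) (suc r) (s≤s r≤j) with suc j <? k
... | yes _ = back-hist k λ' i j r r≤j
... | no _  = back-hist k λ' i j r r≤j

sumFrom2≡∑ : ∀ k f → sumFrom2 k f ≡ ∑[ e < k ∸ 1 ] f (suc (suc e))
sumFrom2≡∑ zero          f = refl
sumFrom2≡∑ (suc zero)    f = refl
sumFrom2≡∑ (suc (suc k)) f =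
  trans (cong (_+ f (suc (suc k))) (sumFrom2≡∑ (suc k) f)) (sym (∑-suc k (λ e → f (suc (suc e)))))

seqShift-step : ∀ k-1 λ' i j → k-1 ≤ j →
  seqShift (suc k-1) λ' i (suc j) ≡ λ' * seqShift (suc k-1) λ' i j + ∑[ e < k-1 ] seqShift (suc k-1) λ' i (j ∸ suc e)
seqShift-step k-1 λ' i j k-1≤j
  rewrite seqShift≡head (suc k-1) λ' i (suc j) | hist-step (suc k-1) λ' i j (λ j+1<k → <⇒≱ (s≤s⁻¹ j+1<k) k-1≤j) =
  cong₂ _+_ (cong (λ' *_) (back-hist (suc k-1) λ' i j 0 z≤n))
    (trans (sumFrom2≡∑ (suc k-1) _)
      (∑-cong k-1 (λ e e<k-1 → back-hist (suc k-1) λ' i j (suc e) (≤-trans e<k-1 k-1≤j))))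

Dℕ : (k λ' s t : ℕ) → ℕ
Dℕ k λ' s t with s ≟ t
... | yes _ = λ'
... | no _  = if ⌊ t ≤? suc s ⌋ ∧ ⌊ s <? t + k ⌋ then 1 else 0

Diℕ : (k λ' i s t : ℕ) → ℕ
Diℕ k λ' i zero    zero    = 1
Diℕ k λ' i zero    (suc t) = if ⌊ t ≟ 0 ⌋ then 1 else 0
Diℕ k λ' i (suc s) zero    = if ⌊ suc s <? k ∸ i + 1 ⌋ then 1 else 0
Diℕ k λ' i (suc s) (suc t) = Dℕ k λ' s t

Dmat-toℕ : ∀ k λ' m (s t : Fin m) → Dmat k λ' m s t ≡ Dℕ k λ' (toℕ s) (toℕ t)
Dmat-toℕ k λ' m s t with toℕ s ≟ toℕ t
... | yes _ = refl
... | no _  = refl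

Dimat-toℕ : ∀ k λ' i n (s t : Fin (suc n)) → Dimat k λ' i n s t ≡ Diℕ k λ' i (toℕ s) (toℕ t)
Dimat-toℕ k λ' i n fzero    fzero    = refl
Dimat-toℕ k λ' i n fzero    (fsuc t) = refl
Dimat-toℕ k λ' i n (fsuc s) fzero    = refl
Dimat-toℕ k λ' i n (fsuc s) (fsuc t) = Dmat-toℕ k λ' n s t

Diℕ-hessenberg : ∀ k λ' i r t → suc r < t → Diℕ k λ' i r t ≡ 0
Diℕ-hessenberg k λ' i zero    (suc zero)    (s≤s ())
Diℕ-hessenberg k λ' i zero    (suc (suc t)) _         = refl
Diℕ-hessenberg k λ' i (suc r) (suc t)       (s≤s r+1<t) with r ≟ t
... | yes refl = ⊥-elim (<-irrefl refl (<-trans (n<1+n r) r+1<t))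
... | no _ with t ≤? suc r
...   | yes t≤r+1 = ⊥-elim (<-irrefl refl (<-≤-trans r+1<t t≤r+1))
...   | no _      = refl

Diℕ-superdiagonal : ∀ k λ' i r → Diℕ k λ' i r (suc r) ≡ 1
Diℕ-superdiagonal k λ' i zero    = refl
Diℕ-superdiagonal k λ' i (suc r) with r ≟ suc r
... | yes r≡r+1 = ⊥-elim (<-irrefl r≡r+1 (n<1+n r))
... | no _ with suc r ≤? suc r | r <? suc r + k
...   | yes _      | yes _       = refl
...   | no r+1≰r+1 | _           = ⊥-elim (r+1≰r+1 ≤-refl)
...   | yes _      | no r≮r+1+k  = ⊥-elim (r≮r+1+k (≤-trans (n<1+n r) (m≤m+n (suc r) k)))

Diℕ-diagonal : ∀ k λ' i m → Diℕ k λ' i (suc m) (suc m) ≡ λ'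
Diℕ-diagonal k λ' i m with m ≟ m
... | yes _  = refl
... | no m≢m = ⊥-elim (m≢m refl)

Dℕ-band : ∀ k-1 λ' m e → e < m → Dℕ (suc k-1) λ' m (m ∸ suc e) ≡ (if ⌊ e <? k-1 ⌋ then 1 else 0)
Dℕ-band k-1 λ' m e e<m with m ≟ m ∸ suc e
... | yes m≡d = ⊥-elim (<-irrefl (sym m≡d) (∸-monoʳ-< {m} {suc e} {0} (s≤s z≤n) e<m))
... | no _ with m ∸ suc e ≤? suc m
...   | no d≰m+1 = ⊥-elim (d≰m+1 (≤-trans (m∸n≤m m (suc e)) (n≤1+n m)))
...   | yes _    = cong (λ b → if b then 1 else 0) (⌊⌋-⇔ (m <? d + suc k-1) (e <? k-1) to from)
  where
  d = m ∸ suc e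
  d+e+1≡m : d + suc e ≡ m
  d+e+1≡m = m∸n+n≡m e<m
  to : m < d + suc k-1 → e < k-1
  to m<d+k = s≤s⁻¹ (+-cancelˡ-< d (suc e) (suc k-1) (subst (_< d + suc k-1) (sym d+e+1≡m) m<d+k))
  from : e < k-1 → m < d + suc k-1
  from e<k-1 = subst (_< d + suc k-1) d+e+1≡m (+-monoʳ-< d (s≤s e<k-1))

Diℕ-firstColumn : ∀ k-1 λ' i-2 m → suc (suc i-2) ≤ suc k-1 →
  Diℕ (suc k-1) λ' (suc (suc i-2)) (suc m) 0 ≡ (if ⌊ m + suc i-2 <? k-1 ⌋ then 1 else 0)
Diℕ-firstColumn k-1 λ' i-2 m i≤k =
  cong (λ b → if b then 1 else 0) (⌊⌋-⇔ (suc m <? x + 1) (m + suc i-2 <? k-1) to from)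
  where
  x = k-1 ∸ suc i-2
  x+i-1≡k-1 : x + suc i-2 ≡ k-1
  x+i-1≡k-1 = m∸n+n≡m (s≤s⁻¹ i≤k)
  to : suc m < x + 1 → m + suc i-2 < k-1
  to q = subst (m + suc i-2 <_) x+i-1≡k-1 (+-monoˡ-< (suc i-2) (s≤s⁻¹ (subst (suc m <_) (+-comm x 1) q)))
  from : m + suc i-2 < k-1 → suc m < x + 1
  from q = subst (suc m <_) (+-comm 1 x) (s≤s (+-cancelʳ-< (suc i-2) m x (subst (m + suc i-2 <_) (sym x+i-1≡k-1) q)))

module OrderK (k-1 λ' i-2 : ℕ) (i≤k : suc (suc i-2) ≤ suc k-1) where

  k = suc k-1
  i = suc (suc i-2)
  D = Diℕ k λ' i

  a : ℕ → ℕ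
  a = seqShift k λ' i

  P : ℕ → ℕ
  P m = hper D m 0 0

  a-initial : ∀ d → d ≤ k-1 → a (k-1 ∸ d) ≡ (if ⌊ d ≟ suc i-2 ⌋ then 1 else 0)
  a-initial d d≤k-1 = trans (seqShift-initial k λ' i (k-1 ∸ d) (s≤s (m∸n≤m k-1 d)))
    (cong (λ b → if b then 1 else 0)
      (trans (cong (λ z → ⌊ i ≟ z ⌋) (trans (+-∸-assoc 1 (m∸n≤m k-1 d)) (cong suc (m∸[m∸n]≡n d≤k-1))))
        (⌊⌋-⇔ (i ≟ suc d) (d ≟ suc i-2) (sym ∘ suc-injective) (cong suc ∘ sym))))

  a-tail : ∀ m → ∑[ e < k-1 ] (if ⌊ e <? m ⌋ then 0 else a (m + k-1 ∸ e)) ≡ (if ⌊ m + suc i-2 <? k-1 ⌋ then 1 else 0)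
  a-tail m = trans (∑-cong k-1 initial) (∑-indicator k-1 (m + suc i-2) 1)
    where
    shifted : ∀ d → m + d < k-1 → a (m + k-1 ∸ (m + d)) ≡ (if ⌊ m + d ≟ m + suc i-2 ⌋ then 1 else 0)
    shifted d m+d<k-1 = trans (cong a ([m+n]∸[m+o]≡n∸o m k-1 d))
      (trans (a-initial d (≤-trans (m≤n+m d m) (<⇒≤ m+d<k-1)))
        (cong (λ b → if b then 1 else 0)
          (⌊⌋-⇔ (d ≟ suc i-2) (m + d ≟ m + suc i-2) (cong (m +_)) (+-cancelˡ-≡ m d (suc i-2)))))
    initial : ∀ e → e < k-1 → (if ⌊ e <? m ⌋ then 0 else a (m + k-1 ∸ e)) ≡ (if ⌊ e ≟ m + suc i-2 ⌋ then 1 else 0)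
    initial e e<k-1 with e <? m
    ... | yes e<m with e ≟ m + suc i-2
    ...   | yes refl = ⊥-elim (<-irrefl refl (<-≤-trans e<m (m≤m+n m (suc i-2))))
    ...   | no _     = refl
    initial e e<k-1 | no e≮m =
      subst (λ e → e < k-1 → a (m + k-1 ∸ e) ≡ (if ⌊ e ≟ m + suc i-2 ⌋ then 1 else 0))
        (m+[n∸m]≡n (≮⇒≥ e≮m)) (shifted (e ∸ m)) e<k-1

  a-split : ∀ m → ∑[ e < k-1 ] a (m + k-1 ∸ e) ≡ ∑[ e < m ⊓ k-1 ] a (m + k-1 ∸ e) + D (suc m) 0
  a-split m = begin
    ∑[ e < k-1 ] a (m + k-1 ∸ e)
      ≡⟨ ∑-cong k-1 (λ e _ → if-split ⌊ e <? m ⌋ (a (m + k-1 ∸ e))) ⟩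
    ∑[ e < k-1 ] ((if ⌊ e <? m ⌋ then a (m + k-1 ∸ e) else 0) + (if ⌊ e <? m ⌋ then 0 else a (m + k-1 ∸ e)))
      ≡⟨ ∑-distrib-+ k-1 _ _ ⟩
    ∑[ e < k-1 ] (if ⌊ e <? m ⌋ then a (m + k-1 ∸ e) else 0) + ∑[ e < k-1 ] (if ⌊ e <? m ⌋ then 0 else a (m + k-1 ∸ e))
      ≡⟨ cong₂ _+_ (trans (∑-below k-1 m _) (cong (λ n → ∑[ e < n ] a (m + k-1 ∸ e)) (⊓-comm k-1 m)))
                   (trans (a-tail m) (sym (Diℕ-firstColumn k-1 λ' i-2 m i≤k))) ⟩
    ∑[ e < m ⊓ k-1 ] a (m + k-1 ∸ e) + D (suc m) 0 ∎
    where open ≡-Reasoning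

  P-one : P 1 ≡ a (suc k-1)
  P-one = sym (begin
    a (suc k-1)
      ≡⟨ seqShift-step k-1 λ' i k-1 ≤-refl ⟩
    λ' * a k-1 + ∑[ e < k-1 ] a (k-1 ∸ suc e)
      ≡⟨ cong₂ _+_ (trans (cong (λ' *_) (a-initial 0 z≤n)) (*-zeroʳ λ')) (∑-cong k-1 (λ e → a-initial (suc e))) ⟩
    ∑[ e < k-1 ] (if ⌊ suc e ≟ suc i-2 ⌋ then 1 else 0)
      ≡⟨ ∑-cong k-1 (λ e _ → cong (λ b → if b then 1 else 0) (⌊⌋-⇔ (suc e ≟ suc i-2) (e ≟ i-2) suc-injective (cong suc))) ⟩
    ∑[ e < k-1 ] (if ⌊ e ≟ i-2 ⌋ then 1 else 0)
      ≡⟨ ∑-indicator k-1 i-2 1 ⟩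
    (if ⌊ i-2 <? k-1 ⌋ then 1 else 0)
      ≡⟨ cong (λ b → if b then 1 else 0) (⌊⌋-true (i-2 <? k-1) (s≤s⁻¹ i≤k)) ⟩
    1 ∎)
    where open ≡-Reasoning

  module _ (m : ℕ) (ih : ∀ {j} → j < suc m → P (suc j) ≡ a (suc (j + k-1))) where

    band-sum : ∑[ j < m ] (P (suc j) * D (suc m) (suc j)) ≡ ∑[ e < m ⊓ k-1 ] a (m + k-1 ∸ e)
    band-sum = trans (∑-reverse m _) (trans (∑-cong m band-term) (∑-below m k-1 _))
      where
      band-term : ∀ e → e < m → P (suc (m ∸ suc e)) * D (suc m) (suc (m ∸ suc e))
                              ≡ (if ⌊ e <? k-1 ⌋ then a (m + k-1 ∸ e) else 0)
      band-term e e<m = begin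
        P (suc (m ∸ suc e)) * Dℕ k λ' m (m ∸ suc e)
          ≡⟨ cong₂ _*_ (ih (s≤s (m∸n≤m m (suc e)))) (Dℕ-band k-1 λ' m e e<m) ⟩
        a (suc (m ∸ suc e + k-1)) * (if ⌊ e <? k-1 ⌋ then 1 else 0)
          ≡⟨ cong (λ n → a n * (if ⌊ e <? k-1 ⌋ then 1 else 0)) (sym (m+k-1∸e e<m)) ⟩
        a (m + k-1 ∸ e) * (if ⌊ e <? k-1 ⌋ then 1 else 0)
          ≡⟨ *-if-1-0 (a (m + k-1 ∸ e)) ⌊ e <? k-1 ⌋ ⟩
        (if ⌊ e <? k-1 ⌋ then a (m + k-1 ∸ e) else 0) ∎
        where
        open ≡-Reasoning
        m+k-1∸e : e < m → m + k-1 ∸ e ≡ suc (m ∸ suc e + k-1)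
        m+k-1∸e e<m = trans (+-∸-comm k-1 (<⇒≤ e<m)) (cong (_+ k-1) (+-∸-assoc 1 e<m))

    P-step : P (suc (suc m)) ≡ a (suc (suc m + k-1))
    P-step = begin
      P (suc (suc m))
        ≡⟨ hper-lastRow D (suc m) 0 0 ⟩
      D (suc m) 0 + ∑[ j < suc m ] (P (suc j) * D (suc m) (suc j))
        ≡⟨ cong (D (suc m) 0 +_) (∑-suc m _) ⟩
      D (suc m) 0 + (∑[ j < m ] (P (suc j) * D (suc m) (suc j)) + P (suc m) * D (suc m) (suc m))
        ≡⟨ cong (λ z → D (suc m) 0 + (∑[ j < m ] (P (suc j) * D (suc m) (suc j)) + z))
             (cong₂ _*_ (ih ≤-refl) (Diℕ-diagonal k λ' i m)) ⟩
      D (suc m) 0 + (∑[ j < m ] (P (suc j) * D (suc m) (suc j)) + a (suc (m + k-1)) * λ')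
        ≡⟨ cong (λ z → D (suc m) 0 + (z + a (suc (m + k-1)) * λ')) band-sum ⟩
      D (suc m) 0 + (∑[ e < m ⊓ k-1 ] a (m + k-1 ∸ e) + a (suc (m + k-1)) * λ')
        ≡⟨ regroup (D (suc m) 0) (∑[ e < m ⊓ k-1 ] a (m + k-1 ∸ e)) (a (suc (m + k-1))) λ' ⟩
      λ' * a (suc (m + k-1)) + (∑[ e < m ⊓ k-1 ] a (m + k-1 ∸ e) + D (suc m) 0)
        ≡⟨ cong (λ' * a (suc (m + k-1)) +_) (a-split m) ⟨
      λ' * a (suc (m + k-1)) + ∑[ e < k-1 ] a (m + k-1 ∸ e)
        ≡⟨ seqShift-step k-1 λ' i (suc (m + k-1)) (m≤n⇒m≤1+n (m≤n+m k-1 m)) ⟨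
      a (suc (suc m + k-1)) ∎
      where
      open ≡-Reasoning
      regroup : ∀ d s x l → d + (s + x * l) ≡ l * x + (s + d)
      regroup = solve 4 (λ d s x l → d :+ (s :+ x :* l) := l :* x :+ (s :+ d)) refl
        where open +-*-Solver

  P≡a : ∀ m → P (suc m) ≡ a (suc (m + k-1))
  P≡a = <-rec _ step
    where
    step : ∀ m → (∀ {j} → j < m → P (suc j) ≡ a (suc (j + k-1))) → P (suc m) ≡ a (suc (m + k-1))
    step zero    _  = P-one
    step (suc m) ih = P-step m ih

theorem1p21 : (k i λ' n : ℕ) → k ≥ 2 → 2 ≤ i → i ≤ k → λ' ≥ 1 → n ≥ 2 →
    per (Dimat k λ' i (n Data.Nat.∸ 1)) ≡ gon k λ' i n
theorem1p21 zero          i             λ' n             ()            _             _   _ _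
theorem1p21 (suc zero)    i             λ' n             (s≤s ())      _             _   _ _
theorem1p21 (suc (suc _)) zero          λ' n             _             ()            _   _ _
theorem1p21 (suc (suc _)) (suc zero)    λ' n             _             (s≤s ())      _   _ _
theorem1p21 (suc (suc _)) (suc (suc _)) λ' zero          _             _             _   _ ()
theorem1p21 (suc (suc _)) (suc (suc _)) λ' (suc zero)    _             _             _   _ (s≤s ())
theorem1p21 (suc k-1) (suc (suc i-2)) λ' (suc (suc n-2)) _ _ i≤k _ _ = begin
  per (Dimat k λ' i (suc n-2))            ≡⟨ per≡per′ n _ D (Dimat-toℕ k λ' i (suc n-2)) ⟩
  per′ n n D                              ≡⟨ Hessenberg.per′-hper D (Diℕ-hessenberg k λ' i) (Diℕ-superdiagonal k λ' i) n ⟩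
  hper D n 0 0                            ≡⟨ OrderK.P≡a k-1 λ' i-2 i≤k (suc n-2) ⟩
  seqShift k λ' i (suc (suc n-2 + k-1))   ≡⟨ cong (seqShift k λ' i) (+-suc (suc n-2) k-1) ⟨
  gon k λ' i n                            ∎
  where
  open ≡-Reasoning
  k = suc k-1
  i = suc (suc i-2)
  n = suc (suc n-2)
  D = Diℕ k λ' i
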